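{- Let $b\ge 0$ and let $a_1,\dots,a_{b+1}$ be integers with $a_i\ge 2$ for all $i$, and set $n=\sum_{i=1}^{b+1}a_i$. Then $$\sum_{i=1}^{b+1}\gamma_t(P_{a_i})\le \gamma_t\Big(P_{n-2b}+\sum_{i=1}^{b}P_2\Big)=\gamma_t(P_{n-2b})+2b.$$
   Context: $P_m$ denotes the path on $m$ vertices; $+$ and $\sum$ applied to graphs denote disjoint union. A total dominating set of a graph without isolated vertices is a vertex set $S$ such that every vertex is adjacent to some vertex of $S$; $\gamma_t(G)$, the total domination number, is the minimum size of such a set. -}

module Defs where

open import Data.Nat using (ℕ; zero; suc; _+_; _⊓_)
open import Data.Nat.Properties using (_≟_)
open import Data.Bool using (Bool; true; false; _∨_)
open import Data.Fin using (Fin; toℕ; splitAt)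
open import Data.Fin.Subset using (Subset; _∈_; ∣_∣)
open import Data.Product using (∃; _×_)
open import Data.Sum using (inj₁; inj₂)
open import Data.List using (List; []; _∷_; map; filter; foldr; _++_)
open import Data.Vec using (Vec; []; _∷_)
open import Relation.Nullary using (Dec; ⌊_⌋)
open import Relation.Binary.PropositionalEquality using (_≡_)
open import Relation.Unary using (Decidable)
open import Data.Fin.Properties using (all?; any?)
open import Data.Fin.Subset.Properties using (_∈?_)
open import Data.Bool.Properties using () renaming (_≟_ to _≟b_)
open import Relation.Nullary.Decidable using (_×-dec_)

record Graph : Set where
  field
    V   : ℕ
    adj : Fin V → Fin V → Bool
open Graph public

P : ℕ → Graph
P m = record { V = m ; adj = λ i j → ⌊ suc (toℕ i) ≟ toℕ j ⌋ ∨ ⌊ suc (toℕ j) ≟ toℕ i ⌋ }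

_⊕_ : Graph → Graph → Graph
G ⊕ H = record { V = V G + V H ; adj = λ i j → f (splitAt (V G) i) (splitAt (V G) j) }
  where
  f : _ → _ → Bool
  f (inj₁ x) (inj₁ y) = adj G x y
  f (inj₂ x) (inj₂ y) = adj H x y
  f _ _ = false

empty : Graph
empty = record { V = 0 ; adj = λ () }

⨁ : List Graph → Graph
⨁ = foldr _⊕_ empty

copies : ℕ → Graph → List Graph
copies zero    G = []
copies (suc k) G = G ∷ copies k G

IsTDS : (G : Graph) → Subset (V G) → Set
IsTDS G S = ∀ v → ∃ λ u → u ∈ S × adj G v u ≡ true

isTDS? : (G : Graph) → Decidable (IsTDS G)
isTDS? G S = all? λ v → any? λ u → (u ∈? S) ×-dec (adj G v u ≟b true)

allSubsets : (n : ℕ) → List (Subset n)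
allSubsets zero    = [] ∷ []
allSubsets (suc n) = map (true ∷_) (allSubsets n) ++ map (false ∷_) (allSubsets n)

-- Total domination number: minimum size of a total dominating set
-- (for graphs without isolated vertices the whole vertex set is one,
-- so the default value V G is never smaller than the true minimum).
γt : Graph → ℕ
γt G = foldr _⊓_ (V G) (map ∣_∣ (filter (isTDS? G) (allSubsets (V G))))

-- Cutting a path P_{m+2+k} at an edge into P_{m+2} and P_{2+k} that share the
-- two end vertices of that edge turns a total dominating set S of the long path
-- into total dominating sets of both pieces: on each piece add the shared vertex
-- that dominates the new end vertex.  The two sets together have |S| + 2
-- elements, so γt(P_x) + γt(P_y) ≤ γt(P_{x+y-2}) + 2 whenever x, y ≥ 2.
-- Iterating this over a_1, …, a_{b+1} gives the inequality, and the equality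
-- holds because γt is additive over disjoint unions and γt(P_2) = 2.
module Submission where

open import Defs
open import Data.Nat using (ℕ; zero; suc; _+_; _*_; _∸_; _≤_; _<_; _⊓_; z≤n; s≤s; s≤s⁻¹)
open import Data.Nat.Properties
open import Data.Bool using (Bool; true; false)
import Data.Fin as Fin
open import Data.Fin using (Fin; toℕ; fromℕ<; splitAt; _↑ˡ_; _↑ʳ_)
open import Data.Fin.Properties using (toℕ<n; toℕ-fromℕ<; splitAt-↑ˡ; splitAt-↑ʳ; splitAt⁻¹-↑ˡ; splitAt⁻¹-↑ʳ)
open import Data.Fin.Subset using (Subset; _∈_; ∣_∣; ⊤)
open import Data.Fin.Subset.Properties using (∣p∣≤n)
open import Data.Vec using (Vec; []; _∷_; _++_; lookup; sum; map)
import Data.Vec as Vec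
open import Data.Vec.Relation.Unary.All using (All; []; _∷_)
open import Data.Vec.Properties using ([]=⇒lookup; lookup⇒[]=; lookup-++ˡ; lookup-++ʳ)
import Data.List as List
open import Data.List.Properties using (foldr-preservesᵒ)
open import Data.List.Membership.Propositional using () renaming (_∈_ to _∈ˡ_)
open import Data.List.Membership.Propositional.Properties
  using (∈-map⁺; ∈-map⁻; ∈-filter⁺; ∈-filter⁻; ∈-++⁺ˡ; ∈-++⁺ʳ; foldr-selective)
import Data.List.Relation.Unary.Any as AnyL
open import Data.Product using (∃; _×_; _,_; proj₂)
open import Data.Sum using (_⊎_; inj₁; inj₂)
open import Relation.Nullary using (yes; no; contradiction)
open import Relation.Binary.PropositionalEquality
open import Data.Nat.Tactic.RingSolver using (solve-∀)

private
  variable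
    m n : ℕ
    G H : Graph

HasTDS : Graph → Set
HasTDS G = ∃ (IsTDS G)

∈-allSubsets : ∀ n (S : Subset n) → S ∈ˡ allSubsets n
∈-allSubsets zero    []          = AnyL.here refl
∈-allSubsets (suc n) (true ∷ S)  = ∈-++⁺ˡ (∈-map⁺ (true ∷_) (∈-allSubsets n S))
∈-allSubsets (suc n) (false ∷ S) =
  ∈-++⁺ʳ (List.map (true ∷_) (allSubsets n)) (∈-map⁺ (false ∷_) (∈-allSubsets n S))

tdsSizes : Graph → List.List ℕ
tdsSizes G = List.map ∣_∣ (List.filter (isTDS? G) (allSubsets (V G)))

γt-minimal : ∀ G {S} → IsTDS G S → γt G ≤ ∣ S ∣
γt-minimal G {S} tds =
  foldr-preservesᵒ min≤ (V G) _ (inj₂ (AnyL.map (λ ∣S∣≡x → ≤-reflexive (sym ∣S∣≡x)) ∣S∣∈))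
  where
  min≤ : ∀ x y → x ≤ ∣ S ∣ ⊎ y ≤ ∣ S ∣ → x ⊓ y ≤ ∣ S ∣
  min≤ x y (inj₁ x≤) = m≤n⇒m⊓o≤n y x≤
  min≤ x y (inj₂ y≤) = m≤n⇒o⊓m≤n x y≤
  ∣S∣∈ : ∣ S ∣ ∈ˡ tdsSizes G
  ∣S∣∈ = ∈-map⁺ ∣_∣ (∈-filter⁺ (isTDS? G) (∈-allSubsets (V G) S) tds)

-- If no listed size undercuts the default V G, any TDS (at most V G elements) is minimum.
γt-attained : ∀ G → HasTDS G → ∃ λ S → IsTDS G S × ∣ S ∣ ≡ γt G
γt-attained G (T , tds) with foldr-selective ⊓-sel (V G) (tdsSizes G)
... | inj₁ γt≡V = T , tds , ≤-antisym (≤-trans (∣p∣≤n T) (≤-reflexive (sym γt≡V))) (γt-minimal G tds)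
... | inj₂ γt∈ with ∈-map⁻ ∣_∣ γt∈
...   | S , S∈ , γt≡∣S∣ =
  S , proj₂ (∈-filter⁻ (isTDS? G) {xs = allSubsets (V G)} S∈) , sym γt≡∣S∣

∣++∣ : (S : Subset m) (T : Subset n) → ∣ S ++ T ∣ ≡ ∣ S ∣ + ∣ T ∣
∣++∣ []          T = refl
∣++∣ (true ∷ S)  T = cong suc (∣++∣ S T)
∣++∣ (false ∷ S) T = ∣++∣ S T

data Side (m n : ℕ) : Fin (m + n) → Set where
  left  : (i : Fin m) → Side m n (i ↑ˡ n)
  right : (j : Fin n) → Side m n (m ↑ʳ j)

side : ∀ m {n} (w : Fin (m + n)) → Side m n w
side m w with splitAt m w in eq
... | inj₁ i = subst (Side m _) (splitAt⁻¹-↑ˡ eq) (left i)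
... | inj₂ j = subst (Side m _) (splitAt⁻¹-↑ʳ eq) (right j)

adj-⊕-↑ˡ : ∀ G H (i k : Fin (V G)) → adj (G ⊕ H) (i ↑ˡ V H) (k ↑ˡ V H) ≡ adj G i k
adj-⊕-↑ˡ G H i k rewrite splitAt-↑ˡ (V G) i (V H) | splitAt-↑ˡ (V G) k (V H) = refl

adj-⊕-↑ʳ : ∀ G H (j l : Fin (V H)) → adj (G ⊕ H) (V G ↑ʳ j) (V G ↑ʳ l) ≡ adj H j l
adj-⊕-↑ʳ G H j l rewrite splitAt-↑ʳ (V G) (V H) j | splitAt-↑ʳ (V G) (V H) l = refl

adj-⊕-↑ˡ↑ʳ : ∀ G H (i : Fin (V G)) (j : Fin (V H)) → adj (G ⊕ H) (i ↑ˡ V H) (V G ↑ʳ j) ≡ false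
adj-⊕-↑ˡ↑ʳ G H i j rewrite splitAt-↑ˡ (V G) i (V H) | splitAt-↑ʳ (V G) (V H) j = refl

adj-⊕-↑ʳ↑ˡ : ∀ G H (j : Fin (V H)) (i : Fin (V G)) → adj (G ⊕ H) (V G ↑ʳ j) (i ↑ˡ V H) ≡ false
adj-⊕-↑ʳ↑ˡ G H j i rewrite splitAt-↑ʳ (V G) (V H) j | splitAt-↑ˡ (V G) i (V H) = refl

module _ (S : Subset m) (T : Subset n) where

  ↑ˡ-∈-++ : ∀ {i} → i ↑ˡ n ∈ S ++ T → i ∈ S
  ↑ˡ-∈-++ {i} p = lookup⇒[]= i S (trans (sym (lookup-++ˡ S T i)) ([]=⇒lookup p))

  ↑ˡ-∈-++⁺ : ∀ {i} → i ∈ S → i ↑ˡ n ∈ S ++ T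
  ↑ˡ-∈-++⁺ {i} p = lookup⇒[]= (i ↑ˡ n) (S ++ T) (trans (lookup-++ˡ S T i) ([]=⇒lookup p))

  ↑ʳ-∈-++ : ∀ {j} → m ↑ʳ j ∈ S ++ T → j ∈ T
  ↑ʳ-∈-++ {j} p = lookup⇒[]= j T (trans (sym (lookup-++ʳ S T j)) ([]=⇒lookup p))

  ↑ʳ-∈-++⁺ : ∀ {j} → j ∈ T → m ↑ʳ j ∈ S ++ T
  ↑ʳ-∈-++⁺ {j} p = lookup⇒[]= (m ↑ʳ j) (S ++ T) (trans (lookup-++ʳ S T j) ([]=⇒lookup p))

IsTDS-⊕ : ∀ {S T} → IsTDS G S → IsTDS H T → IsTDS (G ⊕ H) (S ++ T)
IsTDS-⊕ {G} {H} {S} {T} tdsS tdsT w with side (V G) w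
... | left i  = let k , k∈S , i~k = tdsS i in
  k ↑ˡ V H , ↑ˡ-∈-++⁺ S T k∈S , trans (adj-⊕-↑ˡ G H i k) i~k
... | right j = let l , l∈T , j~l = tdsT j in
  V G ↑ʳ l , ↑ʳ-∈-++⁺ S T l∈T , trans (adj-⊕-↑ʳ G H j l) j~l

IsTDS-⊕ˡ : ∀ {S T} → IsTDS (G ⊕ H) (S ++ T) → IsTDS G S
IsTDS-⊕ˡ {G} {H} {S} {T} tds i with tds (i ↑ˡ V H)
... | u , u∈ , i~u with side (V G) u
...   | left k  = k , ↑ˡ-∈-++ S T u∈ , trans (sym (adj-⊕-↑ˡ G H i k)) i~u
...   | right l with () ← trans (sym (adj-⊕-↑ˡ↑ʳ G H i l)) i~u

IsTDS-⊕ʳ : ∀ {S T} → IsTDS (G ⊕ H) (S ++ T) → IsTDS H T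
IsTDS-⊕ʳ {G} {H} {S} {T} tds j with tds (V G ↑ʳ j)
... | u , u∈ , j~u with side (V G) u
...   | right l = l , ↑ʳ-∈-++ S T u∈ , trans (sym (adj-⊕-↑ʳ G H j l)) j~u
...   | left k with () ← trans (sym (adj-⊕-↑ʳ↑ˡ G H j k)) j~u

HasTDS-⊕ : HasTDS G → HasTDS H → HasTDS (G ⊕ H)
HasTDS-⊕ (S , tdsS) (T , tdsT) = S ++ T , IsTDS-⊕ tdsS tdsT

γt-⊕ : ∀ G H → HasTDS G → HasTDS H → γt (G ⊕ H) ≡ γt G + γt H
γt-⊕ G H hasG hasH
  with γt-attained G hasG | γt-attained H hasH | γt-attained (G ⊕ H) (HasTDS-⊕ hasG hasH)
... | S , tdsS , ∣S∣≡ | T , tdsT , ∣T∣≡ | U , tdsU , ∣U∣≡ with Vec.splitAt (V G) U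
...   | L , R , refl = ≤-antisym
  (begin
    γt (G ⊕ H)      ≤⟨ γt-minimal (G ⊕ H) (IsTDS-⊕ tdsS tdsT) ⟩
    ∣ S ++ T ∣      ≡⟨ ∣++∣ S T ⟩
    ∣ S ∣ + ∣ T ∣   ≡⟨ cong₂ _+_ ∣S∣≡ ∣T∣≡ ⟩
    γt G + γt H     ∎)
  (begin
    γt G + γt H     ≤⟨ +-mono-≤ (γt-minimal G (IsTDS-⊕ˡ {T = R} tdsU))
                                (γt-minimal H (IsTDS-⊕ʳ {S = L} tdsU)) ⟩
    ∣ L ∣ + ∣ R ∣   ≡⟨ ∣++∣ L R ⟨
    ∣ L ++ R ∣      ≡⟨ ∣U∣≡ ⟩
    γt (G ⊕ H)      ∎)
  where open ≤-Reasoning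

HasTDS-copies : ∀ k → HasTDS G → HasTDS (⨁ (copies k G))
HasTDS-copies zero    _    = [] , λ ()
HasTDS-copies (suc k) hasG = HasTDS-⊕ hasG (HasTDS-copies k hasG)

γt-copies : ∀ k G → HasTDS G → γt (⨁ (copies k G)) ≡ k * γt G
γt-copies zero    G _    = refl
γt-copies (suc k) G hasG =
  trans (γt-⊕ G _ hasG (HasTDS-copies k hasG)) (cong (γt G +_) (γt-copies k G hasG))

-- Indices past the end are not members.
member : Subset n → ℕ → Bool
member []      _       = false
member (x ∷ S) zero    = x
member (x ∷ S) (suc u) = member S u

member-lookup : (S : Subset n) (i : Fin n) → member S (toℕ i) ≡ lookup S i
member-lookup (x ∷ S) Fin.zero    = refl
member-lookup (x ∷ S) (Fin.suc i) = member-lookup S i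

member-++ʳ : (L : Subset m) (R : Subset n) (j : ℕ) → member (L ++ R) (m + j) ≡ member R j
member-++ʳ []      R j = refl
member-++ʳ (x ∷ L) R j = member-++ʳ L R j

member-⊤ : ∀ {u} → u < n → member (⊤ {n}) u ≡ true
member-⊤ {suc n} {zero}  _         = refl
member-⊤ {suc n} {suc u} (s≤s u<n) = member-⊤ u<n

infix 4 _∼_
_∼_ : ℕ → ℕ → Set
v ∼ u = suc v ≡ u ⊎ suc u ≡ v

∼⇒≤suc : ∀ {v u} → v ∼ u → u ≤ suc v
∼⇒≤suc (inj₁ refl) = ≤-refl
∼⇒≤suc (inj₂ refl) = m≤n+m _ 2

∼-shift : ∀ m {v u} → m + suc v ∼ u → ∃ λ l → m + l ≡ u × suc v ∼ l
∼-shift m {v} (inj₁ refl) = suc (suc v) , +-suc m (suc v) , inj₁ refl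
∼-shift m {v} (inj₂ 1+u≡) = v , sym (suc-injective (trans 1+u≡ (+-suc m v))) , inj₂ refl

adj-P⇒∼ : (i j : Fin n) → adj (P n) i j ≡ true → toℕ i ∼ toℕ j
adj-P⇒∼ i j i~j with suc (toℕ i) ≟ toℕ j | suc (toℕ j) ≟ toℕ i
adj-P⇒∼ i j i~j  | yes p | _     = inj₁ p
adj-P⇒∼ i j i~j  | no _  | yes q = inj₂ q
adj-P⇒∼ i j ()   | no _  | no _

∼⇒adj-P : (i j : Fin n) → toℕ i ∼ toℕ j → adj (P n) i j ≡ true
∼⇒adj-P i j i∼j with suc (toℕ i) ≟ toℕ j | suc (toℕ j) ≟ toℕ i
∼⇒adj-P i j i∼j         | yes _ | _     = refl
∼⇒adj-P i j i∼j         | no _  | yes _ = refl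
∼⇒adj-P i j (inj₁ p)    | no ¬p | no _  = contradiction p ¬p
∼⇒adj-P i j (inj₂ q)    | no _  | no ¬q = contradiction q ¬q

IsPathTDS : ∀ n → Subset n → Set
IsPathTDS n S = ∀ v → v < n → ∃ λ u → u < n × member S u ≡ true × v ∼ u

IsTDS-P⇒IsPathTDS : ∀ {S} → IsTDS (P n) S → IsPathTDS n S
IsTDS-P⇒IsPathTDS {S = S} tds v v<n with tds (fromℕ< v<n)
... | u , u∈S , v~u = toℕ u , toℕ<n u , trans (member-lookup S u) ([]=⇒lookup u∈S) ,
  subst (_∼ toℕ u) (toℕ-fromℕ< v<n) (adj-P⇒∼ _ u v~u)

IsPathTDS⇒IsTDS-P : ∀ {S} → IsPathTDS n S → IsTDS (P n) S
IsPathTDS⇒IsTDS-P {S = S} ptds v with ptds (toℕ v) (toℕ<n v)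
... | u , u<n , u∈S , v∼u = fromℕ< u<n , lookup⇒[]= _ S lookup≡true ,
  ∼⇒adj-P v _ (subst (toℕ v ∼_) (sym (toℕ-fromℕ< u<n)) v∼u)
  where
  lookup≡true : lookup S (fromℕ< u<n) ≡ true
  lookup≡true = begin
    lookup S (fromℕ< u<n)        ≡⟨ member-lookup S (fromℕ< u<n) ⟨
    member S (toℕ (fromℕ< u<n))  ≡⟨ cong (member S) (toℕ-fromℕ< u<n) ⟩
    member S u                   ≡⟨ u∈S ⟩
    true                         ∎
    where open ≡-Reasoning

IsPathTDS-⊤ : 2 ≤ n → IsPathTDS n ⊤
IsPathTDS-⊤ 2≤n zero    _        = 1 , 2≤n , member-⊤ 2≤n , inj₁ refl
IsPathTDS-⊤ 2≤n (suc w) 1+w<n    = w , w<n , member-⊤ w<n , inj₂ refl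
  where w<n = <-trans (n<1+n w) 1+w<n

HasTDS-P : 2 ≤ n → HasTDS (P n)
HasTDS-P 2≤n = ⊤ , IsPathTDS⇒IsTDS-P (IsPathTDS-⊤ 2≤n)

leftPiece : Subset m → Bool → Subset (m + 2)
leftPiece L y = L ++ true ∷ y ∷ []

rightPiece : Bool → Subset n → Subset (2 + n)
rightPiece x R = x ∷ true ∷ R

member-leftPiece-end : (L : Subset m) (y : Bool) → member (leftPiece L y) m ≡ true
member-leftPiece-end []      y = refl
member-leftPiece-end (_ ∷ L) y = member-leftPiece-end L y

member-leftPiece : (L : Subset m) {x y : Bool} (R : Subset n) (u : ℕ) → u ≤ suc m →
  member (L ++ x ∷ y ∷ R) u ≡ true → member (leftPiece L y) u ≡ true
member-leftPiece []      R zero          _          _  = refl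
member-leftPiece []      R (suc zero)    _          u∈ = u∈
member-leftPiece []      R (suc (suc u)) (s≤s ())   _
member-leftPiece (_ ∷ L) R zero          _          u∈ = u∈
member-leftPiece (_ ∷ L) R (suc u)       (s≤s u≤m)  u∈ = member-leftPiece L R u u≤m u∈

member-rightPiece : (x y : Bool) (R : Subset n) (j : ℕ) →
  member (x ∷ y ∷ R) j ≡ true → member (rightPiece x R) j ≡ true
member-rightPiece x y R zero          j∈ = j∈
member-rightPiece x y R (suc zero)    _  = refl
member-rightPiece x y R (suc (suc j)) j∈ = j∈

<+2⇒≤suc : ∀ m {v} → v < m + 2 → v ≤ suc m
<+2⇒≤suc m {v} v<m+2 = s≤s⁻¹ (subst (v <_) (+-comm m 2) v<m+2)

≤suc⇒<+2 : ∀ m {u} → u ≤ suc m → u < m + 2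
≤suc⇒<+2 m {u} u≤1+m = subst (u <_) (+-comm 2 m) (s≤s u≤1+m)

module _ (L : Subset m) (x y : Bool) (R : Subset n)
         (ptds : IsPathTDS (m + (2 + n)) (L ++ x ∷ y ∷ R)) where

  IsPathTDS-leftPiece : IsPathTDS (m + 2) (leftPiece L y)
  IsPathTDS-leftPiece v v<m+2 with m≤n⇒m<n∨m≡n (<+2⇒≤suc m v<m+2)
  ... | inj₂ refl  = m , ≤suc⇒<+2 m (n≤1+n m) , member-leftPiece-end L y , inj₂ refl
  ... | inj₁ v<1+m with ptds v (≤-<-trans (s≤s⁻¹ v<1+m) (m<m+n m (s≤s z≤n)))
  ...   | u , _ , u∈ , v∼u =
    u , ≤suc⇒<+2 m u≤1+m , member-leftPiece L R u u≤1+m u∈ , v∼u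
    where u≤1+m = ≤-trans (∼⇒≤suc v∼u) v<1+m

  IsPathTDS-rightPiece : IsPathTDS (2 + n) (rightPiece x R)
  IsPathTDS-rightPiece zero    _  = 1 , s≤s (s≤s z≤n) , refl , inj₁ refl
  IsPathTDS-rightPiece (suc v) v< with ptds (m + suc v) (+-monoʳ-< m v<)
  ... | u , u< , u∈ , ∼u with ∼-shift m ∼u
  ...   | l , refl , ∼l = l , +-cancelˡ-< m _ _ u< ,
    member-rightPiece x y R l (trans (sym (member-++ʳ L (x ∷ y ∷ R) l)) u∈) , ∼l

∣leftPiece∣+∣rightPiece∣ : (L : Subset m) (x y : Bool) (R : Subset n) →
  ∣ leftPiece L y ∣ + ∣ rightPiece x R ∣ ≡ ∣ L ++ x ∷ y ∷ R ∣ + 2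
∣leftPiece∣+∣rightPiece∣ L x y R = begin
  ∣ L ++ true ∷ y ∷ [] ∣ + ∣ x ∷ true ∷ R ∣       ≡⟨ cong (_+ _) (∣++∣ L _) ⟩
  ∣ L ∣ + ∣ true ∷ y ∷ [] ∣ + ∣ x ∷ true ∷ R ∣    ≡⟨ +-assoc ∣ L ∣ _ _ ⟩
  ∣ L ∣ + (∣ true ∷ y ∷ [] ∣ + ∣ x ∷ true ∷ R ∣)  ≡⟨ cong (∣ L ∣ +_) (pieces x y) ⟩
  ∣ L ∣ + (∣ x ∷ y ∷ R ∣ + 2)                     ≡⟨ +-assoc ∣ L ∣ _ 2 ⟨
  ∣ L ∣ + ∣ x ∷ y ∷ R ∣ + 2                       ≡⟨ cong (_+ 2) (∣++∣ L _) ⟨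
  ∣ L ++ x ∷ y ∷ R ∣ + 2                          ∎
  where
  open ≡-Reasoning
  pieces : ∀ x y → ∣ true ∷ y ∷ [] ∣ + ∣ x ∷ true ∷ R ∣ ≡ ∣ x ∷ y ∷ R ∣ + 2
  pieces true  true  = +-comm 2 _
  pieces true  false = +-comm 2 _
  pieces false true  = +-comm 2 _
  pieces false false = +-comm 2 _

-- x and y record whether S contains the shared vertices m and m+1.
γt-P-split : ∀ m k → γt (P (m + 2)) + γt (P (2 + k)) ≤ γt (P (m + (2 + k))) + 2
γt-P-split m k with γt-attained (P (m + (2 + k))) (HasTDS-P (≤-trans (m≤m+n 2 k) (m≤n+m _ m)))
... | S , tdsS , ∣S∣≡ with Vec.splitAt m S
...   | L , x ∷ y ∷ R , refl = begin
  γt (P (m + 2)) + γt (P (2 + k))        ≤⟨ +-mono-≤ (γt-minimal _ leftTDS) (γt-minimal _ rightTDS) ⟩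
  ∣ leftPiece L y ∣ + ∣ rightPiece x R ∣  ≡⟨ ∣leftPiece∣+∣rightPiece∣ L x y R ⟩
  ∣ L ++ x ∷ y ∷ R ∣ + 2                 ≡⟨ cong (_+ 2) ∣S∣≡ ⟩
  γt (P (m + (2 + k))) + 2               ∎
  where
  open ≤-Reasoning
  ptds = IsTDS-P⇒IsPathTDS tdsS
  leftTDS : IsTDS (P (m + 2)) (leftPiece L y)
  leftTDS = IsPathTDS⇒IsTDS-P (IsPathTDS-leftPiece L x y R ptds)
  rightTDS : IsTDS (P (2 + k)) (rightPiece x R)
  rightTDS = IsPathTDS⇒IsTDS-P (IsPathTDS-rightPiece L x y R ptds)

γt-P-overlap : ∀ {x y z} → 2 ≤ x → 2 ≤ y → x + y ≡ z + 2 → γt (P x) + γt (P y) ≤ γt (P z) + 2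
γt-P-overlap {z = z} 2≤x 2≤y x+y≡z+2 with m≤n⇒∃[o]m+o≡n 2≤x | m≤n⇒∃[o]m+o≡n 2≤y
... | m , refl | k , refl =
  subst₂ (λ x z → γt (P x) + γt (P (2 + k)) ≤ γt (P z) + 2) (+-comm m 2) m+2+k≡z (γt-P-split m k)
  where
  m+2+k≡z : m + (2 + k) ≡ z
  m+2+k≡z = +-cancelʳ-≡ 2 _ _ (trans (+-comm (m + (2 + k)) 2) x+y≡z+2)

sum≡N+2*b : ∀ b (a : Vec ℕ (suc b)) → All (2 ≤_) a → ∃ λ N → 2 ≤ N × sum a ≡ N + 2 * b
sum≡N+2*b zero    (x ∷ []) (2≤x ∷ []) = x , 2≤x , refl
sum≡N+2*b (suc b) (x ∷ a)  (2≤x ∷ 2≤a) with sum≡N+2*b b a 2≤a | m≤n⇒∃[o]m+o≡n 2≤x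
... | N , 2≤N , sum≡ | m , refl =
  m + N , ≤-trans 2≤N (m≤n+m N m) , trans (cong (2 + m +_) sum≡) (rearrange m N b)
  where
  rearrange : ∀ m N b → 2 + m + (N + 2 * b) ≡ m + N + 2 * suc b
  rearrange = solve-∀

∑γt-P≤ : ∀ b (a : Vec ℕ (suc b)) → All (2 ≤_) a → ∀ N → sum a ≡ N + 2 * b →
  sum (map (λ x → γt (P x)) a) ≤ γt (P N) + 2 * b
∑γt-P≤ zero    (x ∷ []) _           N x+0≡N+0 =
  ≤-reflexive (cong (λ x → γt (P x) + 0) (+-cancelʳ-≡ 0 x N x+0≡N+0))
∑γt-P≤ (suc b) (x ∷ a)  (2≤x ∷ 2≤a) N sum≡ with sum≡N+2*b b a 2≤a
... | N′ , 2≤N′ , sum-a≡ = begin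
  γt (P x) + sum (map (λ x → γt (P x)) a)  ≤⟨ +-monoʳ-≤ (γt (P x)) (∑γt-P≤ b a 2≤a N′ sum-a≡) ⟩
  γt (P x) + (γt (P N′) + 2 * b)           ≡⟨ +-assoc (γt (P x)) _ _ ⟨
  γt (P x) + γt (P N′) + 2 * b             ≤⟨ +-monoˡ-≤ (2 * b) (γt-P-overlap 2≤x 2≤N′ x+N′≡N+2) ⟩
  γt (P N) + 2 + 2 * b                     ≡⟨ +-assoc (γt (P N)) 2 (2 * b) ⟩
  γt (P N) + (2 + 2 * b)                   ≡⟨ cong (γt (P N) +_) (*-suc 2 b) ⟨
  γt (P N) + 2 * suc b                     ∎
  where
  open ≤-Reasoning
  x+N′≡N+2 : x + N′ ≡ N + 2
  x+N′≡N+2 = +-cancelʳ-≡ (2 * b) _ _ (begin-equality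
    x + N′ + 2 * b    ≡⟨ +-assoc x N′ _ ⟩
    x + (N′ + 2 * b)  ≡⟨ cong (x +_) sum-a≡ ⟨
    x + sum a         ≡⟨ sum≡ ⟩
    N + 2 * suc b     ≡⟨ cong (N +_) (*-suc 2 b) ⟩
    N + (2 + 2 * b)   ≡⟨ +-assoc N 2 _ ⟨
    N + 2 + 2 * b     ∎)

corollary3p4 : (b : ℕ) (a : Vec ℕ (suc b)) → All (λ x → 2 ≤ x) a →
    (sum (map (λ x → γt (P x)) a) ≤ γt (P (sum a ∸ 2 * b) ⊕ ⨁ (copies b (P 2))))
    × (γt (P (sum a ∸ 2 * b) ⊕ ⨁ (copies b (P 2))) ≡ γt (P (sum a ∸ 2 * b)) + 2 * b)
corollary3p4 b a 2≤a with sum≡N+2*b b a 2≤a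
... | N , 2≤N , sum≡ rewrite trans (cong (_∸ 2 * b) sum≡) (m+n∸n≡m N (2 * b)) =
  subst (sum (map (λ x → γt (P x)) a) ≤_) (sym γt≡) (∑γt-P≤ b a 2≤a N sum≡) , γt≡
  where
  γt≡ : γt (P N ⊕ ⨁ (copies b (P 2))) ≡ γt (P N) + 2 * b
  γt≡ = begin
    γt (P N ⊕ ⨁ (copies b (P 2)))     ≡⟨ γt-⊕ (P N) _ (HasTDS-P 2≤N) (HasTDS-copies b (HasTDS-P ≤-refl)) ⟩
    γt (P N) + γt (⨁ (copies b (P 2))) ≡⟨ cong (γt (P N) +_) (γt-copies b (P 2) (HasTDS-P ≤-refl)) ⟩
    γt (P N) + b * 2                   ≡⟨ cong (γt (P N) +_) (*-comm b 2) ⟩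
    γt (P N) + 2 * b                   ∎
    where open ≡-Reasoning
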